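{- Let $L$ be a finite set of list items and let ${A}$ be a deterministic projective list update algorithm on $L$ (with a fixed initial list state), described by its state function $S$. Let $\sigma$ be a request sequence, let $x\neq y$ be items, and suppose that the $q$th request $x_{(q)}$ to $x$ and the $l$th request $y_{(l)}$ to $y$ in $\sigma$ are adjacent in $\sigma$ and that swapping these two requests in $\sigma$ yields a sequence $\sigma'$ with $S_{xy}(\sigma')\neq S_{xy}(\sigma)$. Then $x$ and $y$ are adjacent in the list state $S(\sigma)$.
   Context: List update problem: a list state is a linear order of the finite item set $L$, written $[x_1x_2\ldots x_n]$ with $x_1$ at the front. A request sequence is a finite word over $L$. A deterministic list update algorithm with a fixed initial list state is identified with a function $S$ that maps every finite request sequence $\sigma$ to the list state $S(\sigma)$ after serving $\sigma$; $S(\emptyset)$ is the initial list state. For items $x,y$, $\sigma_{xy}$ denotes the subsequence of $\sigma$ consisting of the requests to $x$ or $y$, and $S_{xy}(\sigma)$ denotes the relative order of $x$ and $y$ in $S(\sigma)$ (either $[xy]$ or $[yx]$). The algorithm is projective if $S_{xy}(\sigma)=S_{xy}(\sigma_{xy})$ for all pairs of items $x,y$ and all request sequences $\sigma$. $x_{(q)}$ denotes the $q$th request to $x$ in $\sigma$. Swapping two adjacent requests means exchanging their positions in the sequence. -}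

module Defs where

open import Data.Nat using (ℕ)
open import Data.Fin using (Fin; _≟_)
open import Data.List using (List; []; _∷_; _++_; filter; allFin)
open import Data.List.Relation.Binary.Permutation.Propositional using (_↭_)
open import Data.Product using (_×_; ∃-syntax)
open import Data.Sum using (_⊎_)
open import Relation.Binary.PropositionalEquality using (_≡_)
open import Relation.Nullary.Decidable using (_⊎-dec_)

-- The item set L is Fin n.
-- A list state: a linear order of all n items, given as a list
-- (front first) that is a permutation of all items.
record ListState (n : ℕ) : Set where
  constructor mkState
  field
    items  : List (Fin n)
    isPerm : items ↭ allFin n
open ListState public

Requests : ℕ → Set
Requests n = List (Fin n)

-- A deterministic list update algorithm (with fixed initial state S [])
-- is identified with its state function S.
Algorithm : ℕ → Set
Algorithm n = Requests n → ListState n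

-- Projection of a word onto the letters x, y (keeps order).
-- Used both for σ_xy and for the relative order S_xy of x,y in a list state.
proj : ∀ {n} → Fin n → Fin n → List (Fin n) → List (Fin n)
proj x y = filter (λ z → (z ≟ x) ⊎-dec (z ≟ y))

Sxy : ∀ {n} → Algorithm n → Fin n → Fin n → Requests n → List (Fin n)
Sxy S x y σ = proj x y (items (S σ))

Projective : ∀ {n} → Algorithm n → Set
Projective {n} S = ∀ (x y : Fin n) (σ : Requests n) →
  Sxy S x y σ ≡ Sxy S x y (proj x y σ)

AdjacentIn : ∀ {n} → Fin n → Fin n → List (Fin n) → Set
AdjacentIn x y l =
  ∃[ as ] ∃[ cs ] (l ≡ as ++ x ∷ y ∷ cs ⊎ l ≡ as ++ y ∷ x ∷ cs)

SwapXY : ∀ {n} → Fin n → Fin n → Requests n → Requests n → Set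
SwapXY x y σ σ' = ∃[ α ] ∃[ β ]
  ((σ ≡ α ++ x ∷ y ∷ β × σ' ≡ α ++ y ∷ x ∷ β)
   ⊎ (σ ≡ α ++ y ∷ x ∷ β × σ' ≡ α ++ x ∷ y ∷ β))

-- Projectivity lets S_xy be read off from σ_xy, and swapping the adjacent
-- requests to x and y changes neither σ_xz nor σ_yz for any third item z.
-- Hence, if some z lay between x and y in S(σ), it would lie between them in
-- S(σ') as well, and by transitivity of the list order S_xy(σ') = S_xy(σ).
module Submission where

open import Defs
open import Data.Nat using (ℕ)
open import Data.Fin using (Fin; _≟_)
open import Data.Fin.Properties using (≡-setoid)
open import Data.List using (List; []; _∷_; _++_)
open import Data.List.Properties using (filter-accept; filter-reject; filter-++; filter-≐; ∷-injective)
open import Data.List.Membership.Propositional using (_∈_; _∉_)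
open import Data.List.Membership.Propositional.Properties using (∈-allFin; ∈-filter⁺; ∈-filter⁻)
open import Data.List.Relation.Unary.Any as Any using (here; there)
open import Data.List.Relation.Unary.All as All using ()
open import Data.List.Relation.Unary.All.Properties using (All¬⇒¬Any)
open import Data.List.Relation.Unary.AllPairs using (_∷_)
open import Data.List.Relation.Unary.Unique.Propositional using (Unique)
open import Data.List.Relation.Unary.Unique.Propositional.Properties using (allFin⁺)
open import Data.List.Relation.Binary.Permutation.Propositional using (↭-sym; ↭⇒↭ₛ)
open import Data.List.Relation.Binary.Permutation.Propositional.Properties using (∈-resp-↭)
import Data.List.Relation.Binary.Permutation.Setoid.Properties as Permutationₛ
open import Data.Product using (_×_; _,_; ∃-syntax; proj₁; proj₂)
open import Data.Sum as Sum using (_⊎_; inj₁; inj₂; [_,_])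
open import Data.Empty using (⊥-elim)
open import Function using (_∘_)
open import Relation.Nullary using (Dec; yes; no)
open import Relation.Nullary.Decidable using (_⊎-dec_)
open import Relation.Unary using (Decidable)
open import Relation.Binary.PropositionalEquality using (_≡_; _≢_; refl; sym; trans; cong; subst; module ≡-Reasoning)
open ≡-Reasoning

module _ {n : ℕ} where

  private variable
    a b c d h x y z : Fin n
    l s s′ σ σ′ : List (Fin n)

  private
    pair? : (a b : Fin n) → Decidable (λ z → z ≡ a ⊎ z ≡ b)
    pair? a b z = (z ≟ a) ⊎-dec (z ≟ b)

  proj-accept : h ≡ a ⊎ h ≡ b → proj a b (h ∷ l) ≡ h ∷ proj a b l
  proj-accept {a = a} {b = b} = filter-accept (pair? a b)

  proj-reject : h ≢ a → h ≢ b → proj a b (h ∷ l) ≡ proj a b l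
  proj-reject {a = a} {b = b} h≢a h≢b = filter-reject (pair? a b) [ h≢a , h≢b ]

  proj-comm : ∀ l → proj a b l ≡ proj b a l
  proj-comm {a = a} {b = b} = filter-≐ (pair? a b) (pair? b a) (Sum.swap , Sum.swap)

  proj-prefix-cong : ∀ α → proj a b s ≡ proj a b s′ → proj a b (α ++ s) ≡ proj a b (α ++ s′)
  proj-prefix-cong {a} {b} {s} {s′} α e =
    trans (filter-++ (pair? a b) α s) (trans (cong (proj a b α ++_) e) (sym (filter-++ (pair? a b) α s′)))

  proj-swap : c ≢ a → c ≢ b → ∀ α β → proj a b (α ++ c ∷ d ∷ β) ≡ proj a b (α ++ d ∷ c ∷ β)
  proj-swap {d = d} c≢a c≢b α β = proj-prefix-cong α
    (trans (proj-reject c≢a c≢b) (proj-prefix-cong (d ∷ []) (sym (proj-reject c≢a c≢b))))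

  ∈-proj⁻ : c ∈ proj a b l → c ∈ l
  ∈-proj⁻ {a = a} {b = b} = proj₁ ∘ ∈-filter⁻ (pair? a b)

  proj≡[]⇒∉ : proj a b l ≡ [] → a ∉ l
  proj≡[]⇒∉ {a = a} {b = b} e a∈l with subst (a ∈_) e (∈-filter⁺ (pair? a b) a∈l (inj₁ refl))
  ... | ()

  proj-absent : a ∉ l → b ∉ l → proj a b l ≡ []
  proj-absent {l = []}    _   _   = refl
  proj-absent {l = h ∷ l} a∉l b∉l =
    trans (proj-reject (a∉l ∘ here ∘ sym) (b∉l ∘ here ∘ sym)) (proj-absent (a∉l ∘ there) (b∉l ∘ there))

  proj-absent-cong : a ∉ l → c ∉ l → proj a b l ≡ proj c b l
  proj-absent-cong {l = []}    _   _   = refl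
  proj-absent-cong {a = a} {l = h ∷ l} {c = c} {b = b} a∉l c∉l = head (h ≟ b)
    where
    tail : proj a b l ≡ proj c b l
    tail = proj-absent-cong (a∉l ∘ there) (c∉l ∘ there)
    head : Dec (h ≡ b) → proj a b (h ∷ l) ≡ proj c b (h ∷ l)
    head (yes h≡b) = trans (proj-accept (inj₂ h≡b)) (trans (cong (h ∷_) tail) (sym (proj-accept (inj₂ h≡b))))
    head (no  h≢b) = trans (proj-reject (a∉l ∘ here ∘ sym) h≢b) (trans tail (sym (proj-reject (c∉l ∘ here ∘ sym) h≢b)))

  proj-single : Unique l → a ∈ l → b ∉ l → proj a b l ≡ a ∷ []
  proj-single {a = a} {b = b} (h≢l ∷ _) (here refl) b∉l =
    trans (proj-accept {b = b} (inj₁ refl)) (cong (a ∷_) (proj-absent (All¬⇒¬Any h≢l) (b∉l ∘ there)))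
  proj-single (h≢l ∷ u) (there a∈l) b∉l =
    trans (proj-reject (All.lookup h≢l a∈l) (b∉l ∘ here ∘ sym)) (proj-single u a∈l (b∉l ∘ there))

  infix 4 _≺[_]_
  _≺[_]_ : Fin n → List (Fin n) → Fin n → Set
  a ≺[ l ] b = proj a b l ≡ a ∷ b ∷ []

  module _ (a≢z : a ≢ z) (z≢b : z ≢ b) (a≢b : a ≢ b) where

    private
      accepted : ∀ c d l → h ≡ c ⊎ h ≡ d → proj c d (h ∷ l) ≡ x ∷ s → h ≡ x × proj c d l ≡ s
      accepted _ _ _ h∈cd e = ∷-injective (trans (sym (proj-accept h∈cd)) e)

      rejected : ∀ c d l → h ≢ c → h ≢ d → proj c d (h ∷ l) ≡ s → proj c d l ≡ s
      rejected _ _ _ h≢c h≢d e = trans (sym (proj-reject h≢c h≢d)) e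

      position : ∀ h → h ≡ a ⊎ h ≡ z ⊎ h ≡ b ⊎ (h ≢ a × h ≢ z × h ≢ b)
      position h with h ≟ a | h ≟ z | h ≟ b
      ... | yes h≡a | _       | _       = inj₁ h≡a
      ... | no _    | yes h≡z | _       = inj₂ (inj₁ h≡z)
      ... | no _    | no _    | yes h≡b = inj₂ (inj₂ (inj₁ h≡b))
      ... | no h≢a  | no h≢z  | no h≢b  = inj₂ (inj₂ (inj₂ (h≢a , h≢z , h≢b)))

    -- ≺-trans once a scan of the list from the front has passed a.
    ≺-trans-after : proj a z l ≡ z ∷ [] → proj z b l ≡ z ∷ b ∷ [] → proj a b l ≡ b ∷ []
    ≺-trans-after {l = h ∷ l} e₁ e₂ with position h
    ... | inj₁ refl = ⊥-elim (a≢z (proj₁ (accepted a z l (inj₁ refl) e₁)))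
    ... | inj₂ (inj₁ refl) = trans (proj-reject (a≢z ∘ sym) z≢b)
          (trans (proj-absent-cong {l = l} a∉l z∉l) (proj₂ (accepted z b l (inj₁ refl) e₂)))
      where
      no-a,z : proj a z l ≡ []
      no-a,z = proj₂ (accepted a z l (inj₂ refl) e₁)
      a∉l : a ∉ l
      a∉l = proj≡[]⇒∉ no-a,z
      z∉l : z ∉ l
      z∉l = proj≡[]⇒∉ (trans (proj-comm l) no-a,z)
    ... | inj₂ (inj₂ (inj₁ refl)) = ⊥-elim (z≢b (sym (proj₁ (accepted z b l (inj₂ refl) e₂))))
    ... | inj₂ (inj₂ (inj₂ (h≢a , h≢z , h≢b))) = trans (proj-reject h≢a h≢b)
          (≺-trans-after {l = l} (rejected a z l h≢a h≢z e₁) (rejected z b l h≢z h≢b e₂))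

    ≺-trans : a ≺[ l ] z → z ≺[ l ] b → a ≺[ l ] b
    ≺-trans {l = h ∷ l} e₁ e₂ with position h
    ... | inj₁ refl = trans (proj-accept (inj₁ refl)) (cong (a ∷_)
          (≺-trans-after {l = l} (proj₂ (accepted a z l (inj₁ refl) e₁)) (rejected z b l a≢z a≢b e₂)))
    ... | inj₂ (inj₁ refl) = ⊥-elim (a≢z (sym (proj₁ (accepted a z l (inj₂ refl) e₁))))
    ... | inj₂ (inj₂ (inj₁ refl)) = ⊥-elim (z≢b (sym (proj₁ (accepted z b l (inj₂ refl) e₂))))
    ... | inj₂ (inj₂ (inj₂ (h≢a , h≢z , h≢b))) = trans (proj-reject h≢a h≢b)
          (≺-trans {l = l} (rejected a z l h≢a h≢z e₁) (rejected z b l h≢z h≢b e₂))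

  ≺-∷ : h ∉ l → a ≺[ l ] b → a ≺[ h ∷ l ] b
  ≺-∷ {h} {l} {a} {b} h∉l a≺b = trans (proj-reject h≢a h≢b) a≺b
    where
    h≢a : h ≢ a
    h≢a refl = h∉l (∈-proj⁻ {b = b} (subst (a ∈_) (sym a≺b) (here refl)))
    h≢b : h ≢ b
    h≢b refl = h∉l (∈-proj⁻ {a = a} (subst (b ∈_) (sym a≺b) (there (here refl))))

  Separated : Fin n → Fin n → List (Fin n) → Set
  Separated x y l = ∃[ z ] z ≢ x × z ≢ y × x ≺[ l ] z × z ≺[ l ] y

  Separated-∷ : h ∉ l → Separated x y l → Separated x y (h ∷ l)
  Separated-∷ h∉l (z , z≢x , z≢y , x≺z , z≺y) = z , z≢x , z≢y , ≺-∷ h∉l x≺z , ≺-∷ h∉l z≺y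

  AdjacentIn-∷ : AdjacentIn x y l → AdjacentIn x y (h ∷ l)
  AdjacentIn-∷ {h = h} (as , cs , e) = h ∷ as , cs , Sum.map (cong (h ∷_)) (cong (h ∷_)) e

  AdjacentIn-sym : AdjacentIn x y l → AdjacentIn y x l
  AdjacentIn-sym (as , cs , e) = as , cs , Sum.swap e

  adjacent-or-separated-from-head : Unique (x ∷ l) → y ∈ l → AdjacentIn x y (x ∷ l) ⊎ Separated x y (x ∷ l)
  adjacent-or-separated-from-head {x} {w ∷ r} {y} (x≢wr ∷ w≢r ∷ unique-r) y∈wr with w ≟ y
  ... | yes refl = inj₁ ([] , r , inj₁ refl)
  ... | no w≢y = inj₂ (w , w≢x , w≢y , x≺w , w≺y)
    where
    w≢x : w ≢ x
    w≢x = All.head x≢wr ∘ sym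
    x≢y : x ≢ y
    x≢y = All.lookup x≢wr y∈wr
    y∈r : y ∈ r
    y∈r = Any.tail (w≢y ∘ sym) y∈wr
    x≺w : x ≺[ x ∷ w ∷ r ] w
    x≺w = trans (proj-accept (inj₁ refl)) (cong (x ∷_) (trans (proj-accept (inj₂ refl))
            (cong (w ∷_) (proj-absent (All¬⇒¬Any (All.tail x≢wr)) (All¬⇒¬Any w≢r)))))
    w≺y : w ≺[ x ∷ w ∷ r ] y
    w≺y = trans (proj-reject (w≢x ∘ sym) x≢y) (trans (proj-accept (inj₁ refl))
            (cong (w ∷_) (trans (proj-comm r) (proj-single unique-r y∈r (All¬⇒¬Any w≢r)))))

  adjacent-or-separated : x ≢ y → Unique l → x ∈ l → y ∈ l →
    AdjacentIn x y l ⊎ Separated x y l ⊎ Separated y x l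
  adjacent-or-separated x≢y _ (here refl) (here refl) = ⊥-elim (x≢y refl)
  adjacent-or-separated _ u (here refl) (there y∈l) = Sum.map₂ inj₁ (adjacent-or-separated-from-head u y∈l)
  adjacent-or-separated _ u (there x∈l) (here refl) =
    Sum.map AdjacentIn-sym inj₂ (adjacent-or-separated-from-head u x∈l)
  adjacent-or-separated {l = h ∷ l} x≢y (h≢l ∷ u) (there x∈l) (there y∈l) =
    Sum.map AdjacentIn-∷ (Sum.map (Separated-∷ h∉l) (Separated-∷ h∉l)) (adjacent-or-separated x≢y u x∈l y∈l)
    where
    h∉l : h ∉ l
    h∉l = All¬⇒¬Any h≢l

  SwapXY-sym : SwapXY x y σ σ′ → SwapXY y x σ σ′
  SwapXY-sym (α , β , e) = α , β , Sum.swap e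

  proj-SwapXY : x ≢ a → x ≢ b → SwapXY x y σ σ′ → proj a b σ ≡ proj a b σ′
  proj-SwapXY x≢a x≢b (α , β , inj₁ (refl , refl)) = proj-swap x≢a x≢b α β
  proj-SwapXY x≢a x≢b (α , β , inj₂ (refl , refl)) = sym (proj-swap x≢a x≢b α β)

  ListState-unique : (s : ListState n) → Unique (items s)
  ListState-unique s = Permutationₛ.Unique-resp-↭ (≡-setoid n) (↭⇒↭ₛ (↭-sym (isPerm s))) (allFin⁺ n)

  ∈-ListState : (s : ListState n) (x : Fin n) → x ∈ items s
  ∈-ListState s x = ∈-resp-↭ (↭-sym (isPerm s)) (∈-allFin x)

module _ {n : ℕ} (S : Algorithm n) (projective : Projective S) where

  private variable
    a b x y : Fin n
    σ σ′ : Requests n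

  Sxy-SwapXY : x ≢ a → x ≢ b → SwapXY x y σ σ′ → Sxy S a b σ′ ≡ Sxy S a b σ
  Sxy-SwapXY {a = a} {b = b} {σ = σ} {σ′ = σ′} x≢a x≢b swapped = begin
    Sxy S a b σ′             ≡⟨ projective a b σ′ ⟩
    Sxy S a b (proj a b σ′)  ≡⟨ cong (Sxy S a b) (proj-SwapXY x≢a x≢b swapped) ⟨
    Sxy S a b (proj a b σ)   ≡⟨ projective a b σ ⟨
    Sxy S a b σ              ∎

  Sxy-SwapXY-separated : x ≢ y → SwapXY x y σ σ′ → Separated x y (items (S σ)) →
    Sxy S x y σ′ ≡ Sxy S x y σ
  Sxy-SwapXY-separated {x} {y} {σ} {σ′} x≢y swapped (z , z≢x , z≢y , x≺z , z≺y) =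
    trans (≺-trans x≢z z≢y x≢y {l = items (S σ′)} x≺z′ z≺y′)
      (sym (≺-trans x≢z z≢y x≢y {l = items (S σ)} x≺z z≺y))
    where
    x≢z : x ≢ z
    x≢z = z≢x ∘ sym
    x≺z′ : x ≺[ items (S σ′) ] z
    x≺z′ = trans (Sxy-SwapXY (x≢y ∘ sym) (z≢y ∘ sym) (SwapXY-sym swapped)) x≺z
    z≺y′ : z ≺[ items (S σ′) ] y
    z≺y′ = trans (Sxy-SwapXY x≢z x≢y swapped) z≺y

lemma6 : ∀ {n : ℕ} (S : Algorithm n) → Projective S →
    ∀ (σ σ' : Requests n) (x y : Fin n) → x ≢ y →
    SwapXY x y σ σ' →
    Sxy S x y σ' ≢ Sxy S x y σ →
    AdjacentIn x y (ListState.items (S σ))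
lemma6 S projective σ σ' x y x≢y swapped Sxy-changed
  with adjacent-or-separated x≢y (ListState-unique (S σ)) (∈-ListState (S σ) x) (∈-ListState (S σ) y)
... | inj₁ adjacent = adjacent
... | inj₂ (inj₁ x⋯y) = ⊥-elim (Sxy-changed (Sxy-SwapXY-separated S projective x≢y swapped x⋯y))
... | inj₂ (inj₂ y⋯x) = ⊥-elim (Sxy-changed (begin
  Sxy S x y σ'  ≡⟨ proj-comm (items (S σ')) ⟩
  Sxy S y x σ'  ≡⟨ Sxy-SwapXY-separated S projective (x≢y ∘ sym) (SwapXY-sym swapped) y⋯x ⟩
  Sxy S y x σ   ≡⟨ proj-comm (items (S σ)) ⟨
  Sxy S x y σ   ∎))
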